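{- Let $L$ be a finite lattice with a sub-$M$-chain of length $n$. Then no chain of $L$ has length greater than $n$.
   Context: An element $m$ of a lattice $L$ is left-modular if $(x\vee m)\wedge y=x\vee(m\wedge y)$ for all $x<y$ in $L$. A sub-$M$-chain of $L$ is a maximal chain $\hat0=m_0\lessdot m_1\lessdot\cdots\lessdot m_n=\hat1$ such that for each $i<n$, $m_i$ is left-modular as an element of the interval lattice $[\hat0,m_{i+1}]$. The length of a chain is one less than its number of elements. -}

module Defs where

open import Level using (Level; _⊔_)
open import Data.Nat using (ℕ; suc)
open import Data.Fin using (Fin; zero; inject₁; fromℕ) renaming (suc to fsuc)
open import Data.Product using (Σ; ∃; _×_)
open import Relation.Nullary using (¬_)
open import Relation.Binary.Lattice.Bundles using (BoundedLattice)

module _ {c ℓ₁ ℓ₂ : Level} (L : BoundedLattice c ℓ₁ ℓ₂) where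
  open BoundedLattice L

  _<_ : Carrier → Carrier → Set (ℓ₁ ⊔ ℓ₂)
  x < y = x ≤ y × ¬ (x ≈ y)

  _⋖_ : Carrier → Carrier → Set (c ⊔ ℓ₁ ⊔ ℓ₂)
  x ⋖ y = x < y × (∀ z → ¬ (x < z × z < y))

  IsFinite : Set (c ⊔ ℓ₁)
  IsFinite = Σ ℕ λ k → Σ (Fin k → Carrier) λ f → ∀ x → ∃ λ i → f i ≈ x

  -- a chain of length n: n+1 elements a₀ < a₁ < ... < aₙ
  IsChain : (n : ℕ) → (Fin (suc n) → Carrier) → Set (ℓ₁ ⊔ ℓ₂)
  IsChain n a = ∀ (i : Fin n) → a (inject₁ i) < a (fsuc i)

  -- m is left-modular in the interval [⊥, t]: for all x < y in [⊥, t],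
  -- (x ∨ m) ∧ y ≈ x ∨ (m ∧ y).  Joins/meets in [⊥, t] agree with those of L.
  LeftModularBelow : Carrier → Carrier → Set (c ⊔ ℓ₁ ⊔ ℓ₂)
  LeftModularBelow t m =
    ∀ x y → x ≤ t → y ≤ t → x < y → ((x ∨ m) ∧ y) ≈ (x ∨ (m ∧ y))

  IsSubMChain : (n : ℕ) → (Fin (suc n) → Carrier) → Set (c ⊔ ℓ₁ ⊔ ℓ₂)
  IsSubMChain n m =
    (m zero ≈ ⊥) × (m (fromℕ n) ≈ ⊤)
    × (∀ (i : Fin n) → m (inject₁ i) ⋖ m (fsuc i))
    × (∀ (i : Fin n) → LeftModularBelow (m (fsuc i)) (m (inject₁ i)))

module Submission where

import Defs
open import Defs using (IsFinite; IsChain; IsSubMChain; LeftModularBelow)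
open import Level using (Level; _⊔_)
import Data.Nat as ℕ
open import Data.Nat using (ℕ; zero; suc; z≤n; s≤s)
open import Data.Nat.Properties using (_≤?_)
open import Data.Fin using (Fin; inject₁; fromℕ) renaming (zero to fzero; suc to fsuc)
import Data.Empty
open import Function using (_∘_)
open import Data.Product using (_,_; proj₁)
open import Data.Sum using (_⊎_; inj₁; inj₂)
open import Relation.Nullary using (¬_)
open import Relation.Nullary.Decidable using (decidable-stable)
open import Relation.Binary.Lattice.Bundles using (BoundedLattice)

-- If m ⋖ t and m is left-modular in [⊥, t], then every element z ≤ t satisfies z ≤ m or
-- z ∨ m = t, and left-modularity makes x ↦ x ∧ m strictly monotone on the elements of the
-- second kind.  So meeting with m turns a chain below t into a chain below m that is at most
-- one step shorter, and descending the sub-M-chain bounds the length of every chain by n.  The dichotomy above is classical, so the argument is run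
-- under double negation, which decidability of ≤ on ℕ removes at the end.

module _ {c ℓ₁ ℓ₂ : Level} (L : BoundedLattice c ℓ₁ ℓ₂) where
  open BoundedLattice L

  _<_ : Carrier → Carrier → Set (ℓ₁ ⊔ ℓ₂)
  _<_ = Defs._<_ L

  _⋖_ : Carrier → Carrier → Set (c ⊔ ℓ₁ ⊔ ℓ₂)
  _⋖_ = Defs._⋖_ L

  data ChainBelow : ℕ → Carrier → Set (c ⊔ ℓ₁ ⊔ ℓ₂) where
    single : ∀ {x} → ChainBelow 0 x
    extend : ∀ {k x y z} → ChainBelow k y → y < z → z ≤ x → ChainBelow (suc k) x

  chainBelow-mono : ∀ {k x y} → x ≤ y → ChainBelow k x → ChainBelow k y
  chainBelow-mono _   single             = single
  chainBelow-mono x≤y (extend c y<z z≤x) = extend c y<z (trans z≤x x≤y)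

  ≈⊥⇒¬chainBelow : ∀ {k x} → x ≈ ⊥ → ¬ ChainBelow (suc k) x
  ≈⊥⇒¬chainBelow x≈⊥ (extend {y = y} c (y≤z , y≉z) z≤x) =
    y≉z (antisym y≤z (trans z≤x (trans (reflexive x≈⊥) (minimum y))))

  isChain⇒chainBelow : ∀ k (a : Fin (suc k) → Carrier) → IsChain L k a → ChainBelow k (a (fromℕ k))
  isChain⇒chainBelow zero    _ _     = single
  isChain⇒chainBelow (suc k) a chain =
    extend (isChain⇒chainBelow k (a ∘ inject₁) (chain ∘ inject₁)) (chain (fromℕ k)) refl

  ⋖⇒≤-or-∨≈ : ∀ {m t} → m ⋖ t → ∀ {z} → z ≤ t → ¬ ¬ (z ≤ m ⊎ (z ∨ m) ≈ t)
  ⋖⇒≤-or-∨≈ {m} {t} ((m≤t , _) , nothing-between) {z} z≤t neither =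
    nothing-between (z ∨ m)
      ( (y≤x∨y z m , λ m≈z∨m → neither (inj₁ (trans (x≤x∨y z m) (reflexive (Eq.sym m≈z∨m)))))
      , (∨-least z≤t m≤t , λ z∨m≈t → neither (inj₂ z∨m≈t)) )

  -- With x ∨ m = t, left-modularity gives y = (x ∨ m) ∧ y = x ∨ (m ∧ y); if m ∧ y = m ∧ x
  -- this is x.
  leftModular⇒∧-strict : ∀ {m t x y} → LeftModularBelow L t m → (x ∨ m) ≈ t → y ≤ t →
                         x < y → (x ∧ m) < (y ∧ m)
  leftModular⇒∧-strict {m} {t} {x} {y} modular x∨m≈t y≤t (x≤y , x≉y) =
    ∧-greatest (trans (x∧y≤x x m) x≤y) (x∧y≤y x m) , λ x∧m≈y∧m →
      x≉y (antisym x≤y (trans y≤[x∨m]∧y (trans (reflexive modular-law) (x∨[m∧y]≤x x∧m≈y∧m))))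
    where
    modular-law : ((x ∨ m) ∧ y) ≈ (x ∨ (m ∧ y))
    modular-law = modular x y (trans x≤y y≤t) y≤t (x≤y , x≉y)

    y≤[x∨m]∧y : y ≤ ((x ∨ m) ∧ y)
    y≤[x∨m]∧y = ∧-greatest (trans y≤t (reflexive (Eq.sym x∨m≈t))) refl

    x∨[m∧y]≤x : (x ∧ m) ≈ (y ∧ m) → (x ∨ (m ∧ y)) ≤ x
    x∨[m∧y]≤x x∧m≈y∧m =
      ∨-least refl (trans (∧-greatest (x∧y≤y m y) (x∧y≤x m y))
                          (trans (reflexive (Eq.sym x∧m≈y∧m)) (x∧y≤x x m)))

  -- Split on the element y just below the top z of the chain: if y ≤ m the rest of the chain
  -- already lies below x ∧ m; otherwise y ∧ m < z ∧ m extends the recursively obtained chain.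
  ⋖-leftModular⇒chainBelow-∧ : ∀ {m t} → m ⋖ t → LeftModularBelow L t m →
                               ∀ {k x} → x ≤ t → ChainBelow (suc k) x → ¬ ¬ ChainBelow k (x ∧ m)
  ⋖-leftModular⇒chainBelow-∧ {m} {t} m⋖t modular {k} {x} x≤t (extend {y = y} {z = z} c y<z z≤x) no-chain =
    ⋖⇒≤-or-∨≈ m⋖t y≤t λ
      { (inj₁ y≤m)   → no-chain (chainBelow-mono (∧-greatest y≤x y≤m) c)
      ; (inj₂ y∨m≈t) → shorten c y∨m≈t }
    where
    y≤x : y ≤ x
    y≤x = trans (proj₁ y<z) z≤x

    y≤t : y ≤ t
    y≤t = trans y≤x x≤t

    shorten : ChainBelow k y → (y ∨ m) ≈ t → Data.Empty.⊥
    shorten single           _     = no-chain single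
    shorten c@(extend _ _ _) y∨m≈t =
      ⋖-leftModular⇒chainBelow-∧ m⋖t modular y≤t c λ c′ →
        no-chain (extend c′ (leftModular⇒∧-strict modular y∨m≈t (trans z≤x x≤t) y<z)
                            (∧-greatest (trans (x∧y≤x z m) z≤x) (x∧y≤y z m)))

  subMChain⇒chainBelow-≤ :
    ∀ n (m : Fin (suc n) → Carrier) → m fzero ≈ ⊥ →
    (∀ (i : Fin n) → m (inject₁ i) ⋖ m (fsuc i)) →
    (∀ (i : Fin n) → LeftModularBelow L (m (fsuc i)) (m (inject₁ i))) →
    ∀ {k} → ChainBelow k (m (fromℕ n)) → ¬ ¬ (k ℕ.≤ n)
  subMChain⇒chainBelow-≤ _       _ _    _      _       {zero}  _ k≰n = k≰n z≤n
  subMChain⇒chainBelow-≤ zero    _ m₀≈⊥ _      _       {suc k} c _   = ≈⊥⇒¬chainBelow m₀≈⊥ c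
  subMChain⇒chainBelow-≤ (suc n) m m₀≈⊥ covers modular {suc k} c k≰n =
    ⋖-leftModular⇒chainBelow-∧ (covers (fromℕ n)) (modular (fromℕ n)) refl c λ c′ →
      subMChain⇒chainBelow-≤ n (m ∘ inject₁) m₀≈⊥ (covers ∘ inject₁) (modular ∘ inject₁)
        (chainBelow-mono (x∧y≤y _ _) c′) (λ k≤n → k≰n (s≤s k≤n))

open import Data.Nat using (_≤_)

lemma3p1 : {c ℓ₁ ℓ₂ : Level} (L : BoundedLattice c ℓ₁ ℓ₂) → IsFinite L →
    (n : ℕ) (m : Fin (suc n) → BoundedLattice.Carrier L) → IsSubMChain L n m →
    (k : ℕ) (a : Fin (suc k) → BoundedLattice.Carrier L) → IsChain L k a →
    k ≤ n
lemma3p1 L _ n m (m₀≈⊥ , mₙ≈⊤ , covers , modular) k a chain =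
  decidable-stable (k ≤? n)
    (subMChain⇒chainBelow-≤ L n m m₀≈⊥ covers modular
      (chainBelow-mono L (trans (maximum _) (reflexive (Eq.sym mₙ≈⊤))) (isChain⇒chainBelow L k a chain)))
  where open BoundedLattice L using (trans; maximum; reflexive; module Eq)
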